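{- Let $K$ be a configuration (with $K_{f_0}=n$) and let $f$ be a face such that $K_f>\mathrm{Az}(n)_f>0$. Then there is a configuration $K'$, reachable from $K$ by a finite sequence of firing moves, and a face $g$ such that $\mathrm{dist}(f_0,g)=1+\mathrm{dist}(f_0,f)$ and $K'_g>\mathrm{Az}(n)_g$.
   Context: The grid complex is the tiling of the plane by unit squares ("faces"); two faces are adjacent if they share an edge, and $\mathrm{dist}(f,g)$ is the Manhattan distance between faces. A configuration $K$ assigns an integer weight $K_f$ to each face $f$, with finitely many nonzero weights; there is a marked face $f_0$ with $K_{f_0}=n$. Firing moves: (i) if $f,g$ are adjacent faces, both different from $f_0$, with $K_f\geq K_g+2$, one may fire $f$ towards $g$, decreasing $K_f$ by $1$ and increasing $K_g$ by $1$; (ii) if $g$ is adjacent to $f_0$ and $K_g<n$, one may fire from $f_0$ to $g$, increasing $K_g$ by $1$; (iii) if $g$ is adjacent to $f_0$ and $K_g>n$, one may fire from $g$ to $f_0$, decreasing $K_g$ by $1$; the weight of $f_0$ never changes. The Aztec diamond $\mathrm{Az}(n)$ has $\mathrm{Az}(n)_{f_0}=n$ and $\mathrm{Az}(n)_f=\max\{n-\mathrm{dist}(f_0,f)+1,0\}$ for $f\neq f_0$. -}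

module Defs where

open import Data.Nat as ℕ using (ℕ)
open import Data.Integer using (ℤ; +_; _+_; _-_; _⊔_; _<_; _≤_; ∣_∣; 0ℤ; 1ℤ; -1ℤ)
import Data.Integer.Properties as ℤP
open import Data.Product using (_×_; _,_; proj₁; proj₂)
open import Data.Product.Properties using (≡-dec)
open import Data.List using (List)
open import Data.List.Membership.Propositional using (_∈_)
open import Relation.Binary.PropositionalEquality using (_≡_; _≢_)
open import Relation.Binary.Construct.Closure.ReflexiveTransitive using (Star)
open import Relation.Nullary using (¬_; yes; no)
open import Relation.Nullary.Decidable using (Dec)

-- Faces of the grid complex: unit squares indexed by their lower-left corner in ℤ².
Face : Set
Face = ℤ × ℤ

_≟F_ : (f g : Face) → Dec (f ≡ g)
_≟F_ = ≡-dec ℤP._≟_ ℤP._≟_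

dist : Face → Face → ℕ
dist (x₁ , y₁) (x₂ , y₂) = ∣ x₁ - x₂ ∣ ℕ.+ ∣ y₁ - y₂ ∣

-- Two faces are adjacent iff they share an edge.
Adjacent : Face → Face → Set
Adjacent f g = dist f g ≡ 1

Weights : Set
Weights = Face → ℤ

FiniteSupport : Weights → Set
FiniteSupport K = Data.Product.Σ (List Face) λ S → ∀ f → ¬ (f ∈ S) → K f ≡ 0ℤ

IsConfig : Face → ℕ → Weights → Set
IsConfig f₀ n K = FiniteSupport K × (K f₀ ≡ + n)

addAt : Face → ℤ → Weights → Weights
addAt g d K h with h ≟F g
... | yes _ = K h + d
... | no  _ = K h

data Fire (f₀ : Face) (n : ℕ) : Weights → Weights → Set where
  fire : ∀ {K} f g → f ≢ f₀ → g ≢ f₀ → Adjacent f g →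
         K g + + 2 ≤ K f →
         Fire f₀ n K (addAt g 1ℤ (addAt f -1ℤ K))
  fromMarked : ∀ {K} g → Adjacent f₀ g → K g < + n →
         Fire f₀ n K (addAt g 1ℤ K)
  toMarked : ∀ {K} g → Adjacent g f₀ → + n < K g →
         Fire f₀ n K (addAt g -1ℤ K)

Reachable : Face → ℕ → Weights → Weights → Set
Reachable f₀ n = Star (Fire f₀ n)

Az : Face → ℕ → Weights
Az f₀ n f with f ≟F f₀
... | yes _ = + n
... | no  _ = ((+ n) - (+ dist f₀ f) + 1ℤ) ⊔ 0ℤ

{-# OPTIONS --safe #-}
-- Write level n d = n − d + 1 for the height of Az(n) on the shell of faces at distance d ≥ 1
-- from f₀. By induction on the shell, a face h at distance k + 1 can be raised to any height
-- up to level n (k + 1) without changing the other faces at distance ≥ k + 1: on the first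
-- shell fire from f₀; further out, raise an inward neighbour p of h to K h + 2 and fire p
-- towards h. Given K f > level n (k + 1) with f at distance k + 1, choose an outward neighbour g
-- of f having a second inward neighbour q ≠ f, and raise g to level n (k + 2) through q, which
-- leaves K f alone. Either g now exceeds its level, or f exceeds g by two and fires into it.
module Submission where

open import Defs
open import Data.Nat using (ℕ; suc)
open import Data.Integer using (ℤ; _<_; 0ℤ)
open import Data.Product using (Σ; _×_)
open import Relation.Binary.PropositionalEquality using (_≡_)

import Data.Nat as ℕ
import Data.Nat.Properties as ℕP
open import Data.Integer using (+_; -[1+_]; -≤+; _+_; _-_; -_; _≤_; _⊔_; ∣_∣; 1ℤ; -1ℤ; pred; _≤?_)
import Data.Integer.Properties as ℤP
open import Data.Integer.Tactic.RingSolver using (solve-∀)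
open import Data.Product using (_,_; proj₁; proj₂; ∃-syntax)
import Data.Product as Σ
open import Data.Sum using (_⊎_; inj₁; inj₂)
open import Data.Empty using (⊥-elim)
open import Function using (_∘′_)
open import Relation.Nullary using (yes; no)
open import Relation.Binary.PropositionalEquality
  using (refl; sym; trans; cong; cong₂; subst; subst₂; _≢_)
open import Relation.Binary.Construct.Closure.ReflexiveTransitive using (Star; ε; _◅_; _◅◅_)

i<j⇒i+1≤j : ∀ {i j} → i < j → i + 1ℤ ≤ j
i<j⇒i+1≤j {i} i<j = subst (_≤ _) (ℤP.+-comm 1ℤ i) (ℤP.i<j⇒suc[i]≤j i<j)

i≤j⇒i<j+1 : ∀ {i j} → i ≤ j → i < j + 1ℤ
i≤j⇒i<j+1 {i} {j} i≤j =
  ℤP.suc[i]≤j⇒i<j (subst (_≤ j + 1ℤ) (ℤP.+-comm i 1ℤ) (ℤP.+-monoˡ-≤ 1ℤ i≤j))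

i+2≡i+1+1 : ∀ i → i + + 2 ≡ i + 1ℤ + 1ℤ
i+2≡i+1+1 i = sym (ℤP.+-assoc i 1ℤ 1ℤ)

0<i⊔0⇒0<i : ∀ i → 0ℤ < i ⊔ 0ℤ → 0ℤ < i
0<i⊔0⇒0<i i 0<i⊔0 with i ≤? 0ℤ
... | yes i≤0 = ⊥-elim (ℤP.<-irrefl (sym (ℤP.i≤j⇒i⊔j≡j i≤0)) 0<i⊔0)
... | no i≰0 = ℤP.≰⇒> i≰0

addAt-≡ : ∀ g d K → addAt g d K g ≡ K g + d
addAt-≡ g d K with g ≟F g
... | yes _ = refl
... | no g≢g = ⊥-elim (g≢g refl)

addAt-≢ : ∀ g d K h → h ≢ g → addAt g d K h ≡ K h
addAt-≢ g d K h h≢g with h ≟F g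
... | yes h≡g = ⊥-elim (h≢g h≡g)
... | no _ = refl

dist-self : ∀ f → dist f f ≡ 0
dist-self (x , y) = cong₂ (λ a b → ∣ a ∣ ℕ.+ ∣ b ∣) (ℤP.+-inverseʳ x) (ℤP.+-inverseʳ y)

dist≡0⇒≡ : ∀ f g → dist f g ≡ 0 → f ≡ g
dist≡0⇒≡ (x₁ , y₁) (x₂ , y₂) d≡0 =
  cong₂ _,_ (ℤP.i-j≡0⇒i≡j x₁ x₂ (ℤP.∣i∣≡0⇒i≡0 (ℕP.m+n≡0⇒m≡0 _ d≡0)))
            (ℤP.i-j≡0⇒i≡j y₁ y₂ (ℤP.∣i∣≡0⇒i≡0 (ℕP.m+n≡0⇒n≡0 _ d≡0)))

dist-sym : ∀ f g → dist f g ≡ dist g f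
dist-sym (x₁ , y₁) (x₂ , y₂) = cong₂ ℕ._+_ (ℤP.∣i-j∣≡∣j-i∣ x₁ x₂) (ℤP.∣i-j∣≡∣j-i∣ y₁ y₂)

dist≡suc⇒≢ : ∀ {f₀ f k} → dist f₀ f ≡ suc k → f ≢ f₀
dist≡suc⇒≢ {f₀} d≡suc refl = ℕP.0≢1+n (trans (sym (dist-self f₀)) d≡suc)

centre-or-shell : ∀ f₀ f → f₀ ≡ f ⊎ ∃[ k ] dist f₀ f ≡ suc k
centre-or-shell f₀ f with dist f₀ f in df
... | ℕ.zero = inj₁ (dist≡0⇒≡ f₀ f df)
... | suc k = inj₂ (k , refl)

Adjacent-sym : ∀ f g → Adjacent f g → Adjacent g f
Adjacent-sym f g f~g = trans (dist-sym g f) f~g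

Adjacent⇒≢ : ∀ {f g} → Adjacent f g → f ≢ g
Adjacent⇒≢ {f} f~f refl = ℕP.0≢1+n (trans (sym (dist-self f)) f~f)

step-toward : ∀ w m → ∣ w ∣ ≡ suc m → ∃[ s ] ∣ s ∣ ≡ 1 × ∣ w - s ∣ ≡ m
step-toward (+ suc a) m ∣w∣≡1+m = 1ℤ , refl , ℕP.suc-injective ∣w∣≡1+m
step-toward -[1+ a ] m ∣w∣≡1+m = -1ℤ , refl , trans (∣-[1+a]+1∣ a) (ℕP.suc-injective ∣w∣≡1+m)
  where
  ∣-[1+a]+1∣ : ∀ a → ∣ -[1+ a ] - -1ℤ ∣ ≡ a
  ∣-[1+a]+1∣ ℕ.zero = refl
  ∣-[1+a]+1∣ (suc a) = refl

step-away : ∀ w → ∃[ s ] ∣ s ∣ ≡ 1 × ∣ w - s ∣ ≡ suc ∣ w ∣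
step-away (+ a) = -1ℤ , refl , ℕP.+-comm a 1
step-away -[1+ a ] = 1ℤ , refl , cong (λ b → suc (suc b)) (ℕP.+-identityʳ a)

sub-shift : ∀ a b s → a - (b + s) ≡ a - b - s
sub-shift = solve-∀

dist-shiftˣ : ∀ x₀ y₀ x y s → dist (x₀ , y₀) (x + s , y) ≡ ∣ x₀ - x - s ∣ ℕ.+ ∣ y₀ - y ∣
dist-shiftˣ x₀ y₀ x y s = cong (λ a → ∣ a ∣ ℕ.+ ∣ y₀ - y ∣) (sub-shift x₀ x s)

dist-shiftʸ : ∀ x₀ y₀ x y s → dist (x₀ , y₀) (x , y + s) ≡ ∣ x₀ - x ∣ ℕ.+ ∣ y₀ - y - s ∣
dist-shiftʸ x₀ y₀ x y s = cong (λ a → ∣ x₀ - x ∣ ℕ.+ ∣ a ∣) (sub-shift y₀ y s)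

∣x-[x+s]∣≡∣s∣ : ∀ x s → ∣ x - (x + s) ∣ ≡ ∣ s ∣
∣x-[x+s]∣≡∣s∣ x s = trans (cong ∣_∣ (x-[x+s]≡-s x s)) (ℤP.∣-i∣≡∣i∣ s)
  where
  x-[x+s]≡-s : ∀ x s → x - (x + s) ≡ - s
  x-[x+s]≡-s = solve-∀

adjacent-shiftˣ : ∀ x y s → ∣ s ∣ ≡ 1 → Adjacent (x , y) (x + s , y)
adjacent-shiftˣ x y s ∣s∣≡1 rewrite ℤP.+-inverseʳ y =
  trans (ℕP.+-identityʳ _) (trans (∣x-[x+s]∣≡∣s∣ x s) ∣s∣≡1)

adjacent-shiftʸ : ∀ x y s → ∣ s ∣ ≡ 1 → Adjacent (x , y) (x , y + s)
adjacent-shiftʸ x y s ∣s∣≡1 rewrite ℤP.+-inverseʳ x = trans (∣x-[x+s]∣≡∣s∣ y s) ∣s∣≡1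

shift-≢ : ∀ x s → ∣ s ∣ ≡ 1 → x + s ≢ x
shift-≢ x s ∣s∣≡1 x+s≡x = ℕP.0≢1+n (trans (cong ∣_∣ (sym s≡0)) ∣s∣≡1)
  where
  x+s-x≡s : ∀ x s → x + s - x ≡ s
  x+s-x≡s = solve-∀
  s≡0 : s ≡ 0ℤ
  s≡0 = trans (sym (x+s-x≡s x s)) (trans (cong (_- x) x+s≡x) (ℤP.+-inverseʳ x))

inward-neighbour : ∀ f₀ h k → dist f₀ h ≡ suc k → ∃[ p ] dist f₀ p ≡ k × Adjacent p h
inward-neighbour (x₀ , y₀) (x , y) k d with ∣ y₀ - y ∣ in dy
... | suc m with step-toward (y₀ - y) m dy
...   | s , ∣s∣≡1 , dy′ =
  (x , y + s) ,
  trans (dist-shiftʸ x₀ y₀ x y s)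
        (trans (cong (∣ x₀ - x ∣ ℕ.+_) dy′) (ℕP.suc-injective (trans (sym (ℕP.+-suc _ m)) d))) ,
  Adjacent-sym (x , y) (x , y + s) (adjacent-shiftʸ x y s ∣s∣≡1)
inward-neighbour (x₀ , y₀) (x , y) k d | ℕ.zero
  with step-toward (x₀ - x) k (trans (sym (ℕP.+-identityʳ _)) d)
...   | s , ∣s∣≡1 , dx′ =
  (x + s , y) ,
  trans (dist-shiftˣ x₀ y₀ x y s) (trans (cong₂ ℕ._+_ dx′ dy) (ℕP.+-identityʳ k)) ,
  Adjacent-sym (x , y) (x + s , y) (adjacent-shiftˣ x y s ∣s∣≡1)

outward-neighbour-with-other-inward-neighbour : ∀ f₀ f k → dist f₀ f ≡ suc k →
  ∃[ g ] ∃[ q ] dist f₀ g ≡ suc (suc k) × Adjacent f g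
              × dist f₀ q ≡ suc k × Adjacent q g × q ≢ f
outward-neighbour-with-other-inward-neighbour (x₀ , y₀) (x , y) k d with ∣ y₀ - y ∣ in dy
... | suc m with step-away (x₀ - x) | step-toward (y₀ - y) m dy
...   | e , ∣e∣≡1 , dx′ | s , ∣s∣≡1 , dy′ =
  (x + e , y) , (x + e , y + s) ,
  trans (dist-shiftˣ x₀ y₀ x y e) (trans (cong₂ ℕ._+_ dx′ dy) (cong suc d)) ,
  adjacent-shiftˣ x y e ∣e∣≡1 ,
  trans (dist-shiftʸ x₀ y₀ (x + e) y s)
        (trans (cong₂ (λ a b → ∣ a ∣ ℕ.+ b) (sub-shift x₀ x e) dy′)
               (trans (cong (ℕ._+ m) dx′) (trans (sym (ℕP.+-suc _ m)) d))) ,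
  Adjacent-sym (x + e , y) (x + e , y + s) (adjacent-shiftʸ (x + e) y s ∣s∣≡1) ,
  λ q≡f → shift-≢ x e ∣e∣≡1 (cong proj₁ q≡f)
outward-neighbour-with-other-inward-neighbour (x₀ , y₀) (x , y) k d | ℕ.zero
  with step-away (y₀ - y) | step-toward (x₀ - x) k (trans (sym (ℕP.+-identityʳ _)) d)
...   | e , ∣e∣≡1 , dy′ | s , ∣s∣≡1 , dx′ =
  (x , y + e) , (x + s , y + e) ,
  trans (dist-shiftʸ x₀ y₀ x y e)
        (trans (cong₂ ℕ._+_ (trans (sym (ℕP.+-identityʳ _)) d) (trans dy′ (cong suc dy)))
               (ℕP.+-comm (suc k) 1)) ,
  adjacent-shiftʸ x y e ∣e∣≡1 ,
  trans (dist-shiftˣ x₀ y₀ x (y + e) s)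
        (trans (cong₂ (λ a b → a ℕ.+ ∣ b ∣) dx′ (sub-shift y₀ y e))
               (trans (cong (k ℕ.+_) (trans dy′ (cong suc dy))) (ℕP.+-comm k 1))) ,
  Adjacent-sym (x , y + e) (x + s , y + e) (adjacent-shiftˣ x (y + e) s ∣s∣≡1) ,
  λ q≡f → shift-≢ y e ∣e∣≡1 (cong proj₂ q≡f)

Unchanged : (Face → Set) → Weights → Weights → Set
Unchanged P K K′ = ∀ x → P x → K′ x ≡ K x

Unchanged-trans : ∀ {P K K₁ K₂} → Unchanged P K K₁ → Unchanged P K₁ K₂ → Unchanged P K K₂
Unchanged-trans K≈K₁ K₁≈K₂ x px = trans (K₁≈K₂ x px) (K≈K₁ x px)

module Raising (_⟶_ : Weights → Weights → Set) where

  Incrementable : Face → (Face → Set) → ℤ → Set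
  Incrementable h P b =
    ∀ K → K h < b → ∃[ K′ ] Star _⟶_ K K′ × K′ h ≡ K h + 1ℤ × Unchanged P K K′

  Raisable : Face → (Face → Set) → ℤ → Set
  Raisable h P b =
    ∀ K t → t ≤ b → ∃[ K′ ] Star _⟶_ K K′ × t ≤ K′ h × Unchanged P K K′

  Raisable-mono : ∀ {h P Q b} → (∀ x → Q x → P x) → Raisable h P b → Raisable h Q b
  Raisable-mono Q⊆P raise K t t≤b with raise K t t≤b
  ... | K′ , K↝K′ , t≤K′h , K≈K′ = K′ , K↝K′ , t≤K′h , λ x qx → K≈K′ x (Q⊆P x qx)

  incrementable⇒raisable : ∀ {h P b} → Incrementable h P b → Raisable h P b
  incrementable⇒raisable {h} {P} {b} increment K t t≤b =
    iterate ∣ t - K h ∣ K (subst (_≤ K h + + ∣ t - K h ∣) t≡Kh+[t-Kh]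
                                  (ℤP.+-monoʳ-≤ (K h) (i≤+∣i∣ (t - K h))))
    where
    i≤+∣i∣ : ∀ i → i ≤ + ∣ i ∣
    i≤+∣i∣ (+ _) = ℤP.≤-refl
    i≤+∣i∣ -[1+ _ ] = -≤+
    a+[b-a]≡b : ∀ a b → a + (b - a) ≡ b
    a+[b-a]≡b = solve-∀
    t≡Kh+[t-Kh] : K h + (t - K h) ≡ t
    t≡Kh+[t-Kh] = a+[b-a]≡b (K h) t
    refuel : ∀ N K K₁ → K₁ h ≡ K h + 1ℤ → t ≤ K h + + suc N → t ≤ K₁ h + + N
    refuel N K K₁ K₁h≡Kh+1 =
      subst (t ≤_) (trans (sym (ℤP.+-assoc (K h) 1ℤ (+ N))) (cong (_+ + N) (sym K₁h≡Kh+1)))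
    iterate : ∀ N K → t ≤ K h + + N → ∃[ K′ ] Star _⟶_ K K′ × t ≤ K′ h × Unchanged P K K′
    iterate ℕ.zero K t≤Kh+0 = K , ε , subst (t ≤_) (ℤP.+-identityʳ (K h)) t≤Kh+0 , λ _ _ → refl
    iterate (suc N) K t≤Kh+N with t ≤? K h
    ... | yes t≤Kh = K , ε , t≤Kh , λ _ _ → refl
    ... | no t≰Kh with increment K (ℤP.<-≤-trans (ℤP.≰⇒> t≰Kh) t≤b)
    ...   | K₁ , K↝K₁ , K₁h≡Kh+1 , K≈K₁ with iterate N K₁ (refuel N K K₁ K₁h≡Kh+1 t≤Kh+N)
    ...     | K₂ , K₁↝K₂ , t≤K₂h , K₁≈K₂ = K₂ , K↝K₁ ◅◅ K₁↝K₂ , t≤K₂h , Unchanged-trans K≈K₁ K₁≈K₂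

level : ℕ → ℕ → ℤ
level n d = + n - + d + 1ℤ

level-suc : ∀ n d → level n d ≡ level n (suc d) + 1ℤ
level-suc n d = a-b+1≡a-[1+b]+1+1 (+ n) (+ d)
  where
  a-b+1≡a-[1+b]+1+1 : ∀ a b → a - b + 1ℤ ≡ a - (1ℤ + b) + 1ℤ + 1ℤ
  a-b+1≡a-[1+b]+1+1 = solve-∀

level-one : ∀ n → level n 1 ≡ + n
level-one n = a-1+1≡a (+ n)
  where
  a-1+1≡a : ∀ a → a - 1ℤ + 1ℤ ≡ a
  a-1+1≡a = solve-∀

0<level⇒0≤level-suc : ∀ n d → 0ℤ < level n d → 0ℤ ≤ level n (suc d)
0<level⇒0≤level-suc n d 0<lvl =
  subst (0ℤ ≤_) (trans (cong pred (level-suc n d)) (pred[a+1]≡a (level n (suc d))))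
        (ℤP.i<j⇒i≤pred[j] 0<lvl)
  where
  pred[a+1]≡a : ∀ a → -1ℤ + (a + 1ℤ) ≡ a
  pred[a+1]≡a = solve-∀

<level-suc⇒+2≤level : ∀ n d {i} → i < level n (suc d) → i + + 2 ≤ level n d
<level-suc⇒+2≤level n d {i} i<lvl =
  subst₂ _≤_ (sym (i+2≡i+1+1 i)) (sym (level-suc n d)) (ℤP.+-monoˡ-≤ 1ℤ (i<j⇒i+1≤j i<lvl))

level<⇒level-suc+2≤ : ∀ n d {i} → level n d < i → level n (suc d) + + 2 ≤ i
level<⇒level-suc+2≤ n d lvl<i =
  subst (_≤ _) (sym (trans (i+2≡i+1+1 (level n (suc d))) (cong (_+ 1ℤ) (sym (level-suc n d)))))
        (i<j⇒i+1≤j lvl<i)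

Az-centre : ∀ f₀ n → Az f₀ n f₀ ≡ + n
Az-centre f₀ n with f₀ ≟F f₀
... | yes _ = refl
... | no f₀≢f₀ = ⊥-elim (f₀≢f₀ refl)

Az-shell : ∀ f₀ f n {d} → dist f₀ f ≡ suc d → Az f₀ n f ≡ level n (suc d) ⊔ 0ℤ
Az-shell f₀ f n df with f ≟F f₀
... | yes f≡f₀ = ⊥-elim (dist≡suc⇒≢ df f≡f₀)
... | no _ = cong (λ d → level n d ⊔ 0ℤ) df

Az-shell-nonneg : ∀ f₀ f n {d} → dist f₀ f ≡ suc d → 0ℤ ≤ level n (suc d) →
  Az f₀ n f ≡ level n (suc d)
Az-shell-nonneg f₀ f n df 0≤lvl = trans (Az-shell f₀ f n df) (ℤP.i≥j⇒i⊔j≡i 0≤lvl)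

module Firing (f₀ : Face) (n : ℕ) where
  open Raising (Fire f₀ n)

  Outside : ℕ → Face → Face → Set
  Outside k p x = suc k ℕ.≤ dist f₀ x × x ≢ p

  fire-once : ∀ K f g → f ≢ f₀ → g ≢ f₀ → Adjacent f g → K g + + 2 ≤ K f →
    ∃[ K′ ] Reachable f₀ n K K′ × K′ g ≡ K g + 1ℤ × Unchanged (λ x → x ≢ f × x ≢ g) K K′
  fire-once K f g f≢f₀ g≢f₀ f~g Kg+2≤Kf =
    addAt g 1ℤ (addAt f -1ℤ K) ,
    fire f g f≢f₀ g≢f₀ f~g Kg+2≤Kf ◅ ε ,
    trans (addAt-≡ g 1ℤ _) (cong (_+ 1ℤ) (addAt-≢ f -1ℤ K g (Adjacent⇒≢ f~g ∘′ sym))) ,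
    λ x (x≢f , x≢g) → trans (addAt-≢ g 1ℤ _ x x≢g) (addAt-≢ f -1ℤ K x x≢f)

  next-shell-outside : ∀ {k p h} → dist f₀ h ≡ suc (suc k) → Adjacent p h → Outside k p h
  next-shell-outside {k} {p} {h} dh p~h =
    ℕP.≤-trans (ℕP.n≤1+n (suc k)) (ℕP.≤-reflexive (sym dh)) , Adjacent⇒≢ (Adjacent-sym p h p~h)

  increment-via-inward-neighbour : ∀ {k p h} →
    dist f₀ p ≡ suc k → dist f₀ h ≡ suc (suc k) → Adjacent p h →
    Raisable p (Outside k p) (level n (suc k)) →
    Incrementable h (λ x → Outside k p x × x ≢ h) (level n (suc (suc k)))
  increment-via-inward-neighbour {k} {p} {h} dp dh p~h raise-p K Kh<lvl
    with raise-p K (K h + + 2) (<level-suc⇒+2≤level n (suc k) Kh<lvl)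
  ... | K₁ , K↝K₁ , Kh+2≤K₁p , K≈K₁
    with K≈K₁ h (next-shell-outside dh p~h)
  ... | K₁h≡Kh
    with fire-once K₁ p h (dist≡suc⇒≢ dp) (dist≡suc⇒≢ dh) p~h
                   (subst (λ z → z + + 2 ≤ K₁ p) (sym K₁h≡Kh) Kh+2≤K₁p)
  ... | K₂ , K₁↝K₂ , K₂h≡K₁h+1 , K₁≈K₂ =
    K₂ , K↝K₁ ◅◅ K₁↝K₂ , trans K₂h≡K₁h+1 (cong (_+ 1ℤ) K₁h≡Kh) ,
    λ x ((k<dx , x≢p) , x≢h) → trans (K₁≈K₂ x (x≢p , x≢h)) (K≈K₁ x (k<dx , x≢p))

  shell-raisable : ∀ k h → dist f₀ h ≡ suc k → Raisable h (Outside k h) (level n (suc k))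
  shell-raisable ℕ.zero h dh = incrementable⇒raisable increment-from-marked
    where
    increment-from-marked : Incrementable h (Outside 0 h) (level n 1)
    increment-from-marked K Kh<lvl =
      addAt h 1ℤ K , fromMarked h dh (subst (K h <_) (level-one n) Kh<lvl) ◅ ε ,
      addAt-≡ h 1ℤ K , λ x (_ , x≢h) → addAt-≢ h 1ℤ K x x≢h
  shell-raisable (suc k) h dh with inward-neighbour f₀ h (suc k) dh
  ... | p , dp , p~h =
    Raisable-mono inside-previous
      (incrementable⇒raisable
        (increment-via-inward-neighbour dp dh p~h (shell-raisable k p dp)))
    where
    inside-previous : ∀ x → Outside (suc k) h x → Outside k p x × x ≢ h
    inside-previous x (k+1<dx , x≢h) =
      (ℕP.<⇒≤ k+1<dx , λ { refl → ℕP.<-irrefl (sym dp) k+1<dx }) , x≢h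

  overflow-outward : ∀ K f k → dist f₀ f ≡ suc k → level n (suc k) < K f →
    ∃[ K′ ] ∃[ g ] Reachable f₀ n K K′ × dist f₀ g ≡ suc (suc k) × level n (suc (suc k)) < K′ g
  overflow-outward K f k df lvl<Kf with outward-neighbour-with-other-inward-neighbour f₀ f k df
  ... | g , q , dg , f~g , dq , q~g , q≢f
    with incrementable⇒raisable
           (increment-via-inward-neighbour dq dg q~g (shell-raisable k q dq))
           K (level n (suc (suc k))) ℤP.≤-refl
  ... | K₁ , K↝K₁ , lvl≤K₁g , K≈K₁ with K₁ g ≤? level n (suc (suc k))
  ... | no K₁g≰lvl = K₁ , g , K↝K₁ , dg , ℤP.≰⇒> K₁g≰lvl
  ... | yes K₁g≤lvl
    with K≈K₁ f ((ℕP.≤-reflexive (sym df) , q≢f ∘′ sym) , Adjacent⇒≢ f~g)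
  ... | K₁f≡Kf
    with fire-once K₁ f g (dist≡suc⇒≢ df) (dist≡suc⇒≢ dg) f~g
           (subst (K₁ g + + 2 ≤_) (sym K₁f≡Kf)
                  (ℤP.≤-trans (ℤP.+-monoˡ-≤ (+ 2) K₁g≤lvl)
                              (level<⇒level-suc+2≤ n (suc k) lvl<Kf)))
  ... | K₂ , K₁↝K₂ , K₂g≡K₁g+1 , _ =
    K₂ , g , K↝K₁ ◅◅ K₁↝K₂ , dg , subst (_ <_) (sym K₂g≡K₁g+1) (i≤j⇒i<j+1 lvl≤K₁g)

  overflow-outward-Az : ∀ (K : Weights) f k → dist f₀ f ≡ suc k →
    Az f₀ n f < K f → 0ℤ < Az f₀ n f →
    ∃[ K′ ] ∃[ g ] Reachable f₀ n K K′ × dist f₀ g ≡ suc (suc k) × Az f₀ n g < K′ g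
  overflow-outward-Az K f k df Az<Kf 0<Az =
    Σ.map₂ (Σ.map₂ λ {g} (K↝K′ , dg , lvl<K′g) →
      K↝K′ , dg , subst (_< _) (sym (Az-shell-nonneg f₀ g n dg 0≤lvl′)) lvl<K′g)
    (overflow-outward K f k df
      (subst (_< K f) (Az-shell-nonneg f₀ f n df (ℤP.<⇒≤ 0<lvl)) Az<Kf))
    where
    0<lvl : 0ℤ < level n (suc k)
    0<lvl = 0<i⊔0⇒0<i (level n (suc k)) (subst (0ℤ <_) (Az-shell f₀ f n df) 0<Az)
    0≤lvl′ : 0ℤ ≤ level n (suc (suc k))
    0≤lvl′ = 0<level⇒0≤level-suc n (suc k) 0<lvl

lemma5p5 : (f₀ : Face) (n : ℕ) (K : Weights) → IsConfig f₀ n K →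
           (f : Face) → Az f₀ n f < K f → 0ℤ < Az f₀ n f →
           Σ Weights λ K′ → Σ Face λ g →
             Reachable f₀ n K K′ × (dist f₀ g ≡ suc (dist f₀ f)) × (Az f₀ n g < K′ g)
lemma5p5 f₀ n K (_ , Kf₀≡n) f Az<Kf 0<Az with centre-or-shell f₀ f
... | inj₁ refl = ⊥-elim (ℤP.<-irrefl (trans (Az-centre f₀ n) (sym Kf₀≡n)) Az<Kf)
... | inj₂ (k , df) =
  Σ.map₂ (Σ.map₂ (Σ.map₂ (Σ.map₁ λ dg → trans dg (cong suc (sym df)))))
    (Firing.overflow-outward-Az f₀ n K f k df Az<Kf 0<Az)
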